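{- The operators $U_i=\kappa_i+\Theta_i$ ($i\ge1$) on $\mathbf{k}[\mathcal{P}]$ satisfy the weak Knuth relations: (1) $U_jU_iU_k=U_jU_kU_i$ for all $i\ge j>k$ with $i-k\ge2$; (2) $U_iU_kU_j=U_kU_iU_j$ for all $i>j\ge k$ with $i-k\ge2$; (3) $(U_i+U_{i+1})U_{i+1}U_i=U_{i+1}U_i(U_i+U_{i+1})$ for all $i\ge1$.
   Context: Let $\mathbf{k}$ be a field of characteristic $0$ containing parameters $\alpha_1,\alpha_2,\dots$ and $\beta_1,\beta_2,\dots$ (e.g. the field of rational functions in them), and set $\alpha_0=0$. Let $\mathcal{P}$ be the set of all partitions, regarded as infinite weakly decreasing sequences $(\lambda_1,\lambda_2,\dots)$ of nonnegative integers with finitely many nonzero terms, with the convention $\lambda_0=\infty$, and let $\mathbf{k}[\mathcal{P}]$ be the vector space with basis $\mathcal{P}$. For $i\ge1$ define linear operators: $\kappa_i\cdot\lambda$ is the partition obtained by adding one box to row $i$ of $\lambda$ if $\lambda_i<\lambda_{i-1}$, and $0$ otherwise; $\Theta_i\cdot\lambda=-\alpha_{\lambda_i}\lambda$ if $\lambda_i<\lambda_{i-1}$ and $\Theta_i\cdot\lambda=\beta_{i-1}\lambda$ if $\lambda_i=\lambda_{i-1}$. -}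

module Defs where

open import Level using (Level; _⊔_)
open import Algebra.Bundles using (CommutativeRing)
open import Data.Bool using (Bool; true; false; if_then_else_)
open import Data.Nat as ℕ using (ℕ; zero; suc)
open import Data.Nat.Properties as ℕP using ()
open import Data.List as L using (List; []; _∷_; _++_; [_])
open import Data.List.Relation.Unary.All using (All)
open import Data.List.Relation.Unary.Linked using (Linked)
open import Data.List.Properties using (≡-dec)
open import Data.Product using (_×_; _,_; Σ; proj₁; proj₂)
open import Relation.Nullary using (¬_; does)
open import Relation.Binary.PropositionalEquality using (_≡_)

-- Partitions, encoded as the finite list (λ₁, λ₂, …, λ_ℓ) of their
-- nonzero parts.  (λ_r = 0 for r > ℓ.)  This encoding is canonical.

IsPartition : List ℕ → Set
IsPartition xs = All (λ x → 1 ℕ.≤ x) xs × Linked (λ a b → b ℕ.≤ a) xs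

-- λ_{r+1}, i.e. 0-indexed lookup, 0 beyond the length
part : List ℕ → ℕ → ℕ
part []       _       = 0
part (x ∷ xs) zero    = x
part (x ∷ xs) (suc r) = part xs r

-- "λ_i < λ_{i-1}" (with λ_0 = ∞); only meaningful for i ≥ 1
addable : List ℕ → ℕ → Bool
addable λ′ zero                = false
addable λ′ (suc zero)          = true
addable λ′ (suc (suc r))       = does (part λ′ (suc r) ℕ.<? part λ′ r)

-- add a box to the row with 0-based index r (appending a row of length 1
-- when r is the current length)
incr : List ℕ → ℕ → List ℕ
incr []       _       = 1 ∷ []
incr (x ∷ xs) zero    = suc x ∷ xs
incr (x ∷ xs) (suc r) = x ∷ incr xs r

module _ {c ℓ : Level} (R : CommutativeRing c ℓ) where
  open CommutativeRing R

  natMul : ℕ → Carrier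
  natMul zero    = 0#
  natMul (suc n) = 1# + natMul n

  record IsFieldChar0 : Set (c ⊔ ℓ) where
    field
      nontrivial : ¬ (1# ≈ 0#)
      inverse    : ∀ x → ¬ (x ≈ 0#) → Σ Carrier (λ y → (x * y) ≈ 1#)
      char0      : ∀ n → ¬ (natMul (suc n) ≈ 0#)

-- The vector space k[P]: finite formal linear combinations, represented
-- as lists of (coefficient, basis partition); two vectors are equal iff
-- all their coefficients agree.

module KP {c ℓ : Level} (R : CommutativeRing c ℓ)
          (α β : ℕ → CommutativeRing.Carrier R) where
  open CommutativeRing R

  Vec : Set c
  Vec = List (Carrier × List ℕ)

  InKP : Vec → Set c
  InKP v = All (λ p → IsPartition (proj₂ p)) v

  coeff : Vec → List ℕ → Carrier
  coeff []             μ = 0#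
  coeff ((a , λ′) ∷ v) μ =
    if does (≡-dec ℕP._≟_ λ′ μ) then a + coeff v μ else coeff v μ

  _≈V_ : Vec → Vec → Set ℓ
  v ≈V w = ∀ μ → coeff v μ ≈ coeff w μ

  linExt : (List ℕ → Vec) → Vec → Vec
  linExt f []             = []
  linExt f ((a , λ′) ∷ v) = L.map (λ p → (a * proj₁ p , proj₂ p)) (f λ′) ++ linExt f v

  κb : ℕ → List ℕ → Vec
  κb i λ′ = if addable λ′ i then [ (1# , incr λ′ (ℕ.pred i)) ] else []

  Θb : ℕ → List ℕ → Vec
  Θb i λ′ = if addable λ′ i then [ (- α (part λ′ (ℕ.pred i)) , λ′) ]
                             else [ (β (ℕ.pred i) , λ′) ]

  U : ℕ → Vec → Vec
  U i = linExt (λ λ′ → κb i λ′ ++ Θb i λ′)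

  _⊕_ : (Vec → Vec) → (Vec → Vec) → Vec → Vec
  (f ⊕ g) v = f v ++ g v

-- Far apart, U_i and U_k commute: κ_i κ_k = κ_k κ_i, and the scalar by which Θ_i acts
-- only reads rows i − 1 and i, which κ_k leaves alone (and symmetrically). This gives
-- (1) and (2). For (3) only rows i and i + 1 move: every partition reached from λ is
-- λ with x boxes added to row i and y to row i + 1, and its addable rows and Θ-scalars
-- depend only on x, y, the gaps g₁ = λ_{i-1} − λ_i, g₂ = λ_i − λ_{i+1} and on λ_{i+1}.
-- So both sides of (3) on a basis vector are images of one finite model, in which
-- they agree as polynomials in the β's, the α's and the basis vectors, case by case
-- over the few relevant ranges of (g₁, g₂).

module Submission where

open import Defs
open import Level using (Level; _⊔_)
open import Algebra.Bundles using (CommutativeRing)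
import Algebra.Properties.CommutativeSemigroup as CommutativeSemigroupProperties
open import Data.Bool using (Bool; true; false; T; if_then_else_)
open import Data.Empty using (⊥-elim)
open import Data.Fin using (Fin; #_)
open import Data.Maybe using (Maybe; just; nothing)
open import Data.Nat as ℕ using (ℕ; zero; suc; _<ᵇ_; z≤n; s≤s)
import Data.Nat.Properties as ℕP
open import Data.List as L using (List; []; _∷_; _++_; [_])
import Data.List.Properties as LP
open import Data.List.Properties using (≡-dec)
open import Data.List.Membership.Propositional using (_∈_)
open import Data.List.Relation.Unary.All as All using (All; []; _∷_)
import Data.List.Relation.Unary.All.Properties as AllP
open import Data.List.Relation.Unary.Any using (here; there)
import Data.List.Relation.Unary.Any.Properties as AnyP
open import Data.List.Relation.Unary.Linked using (Linked; _∷_)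
open import Data.Product using (_×_; _,_; Σ; proj₁; proj₂; map₂)
open import Data.Unit using (⊤; tt)
import Data.Vec as V
open import Function using (_∘_)
open import Relation.Nullary using (¬_; Dec; yes; no; does)
open import Relation.Nullary.Decidable using (dec-false)
import Relation.Binary.PropositionalEquality as ≡
open import Relation.Binary.PropositionalEquality using (_≡_)
import Relation.Binary.Reasoning.Setoid as SetoidReasoning

Ushape : ∀ {a b} {T : Set a} {P : Set b} → T → Bool → P → P → T → T → List (T × P)
Ushape one true  p p⁺ θ b = (one , p⁺) ∷ (θ , p) ∷ []
Ushape one false p p⁺ θ b = (b , p) ∷ []

Ushape-map : ∀ {a b d} {T : Set a} {P : Set b} {Q : Set d} (f : P → Q) one c p p⁺ q⁺ (θ b : T) →
             (c ≡ true → q⁺ ≡ f p⁺) → Ushape one c (f p) q⁺ θ b ≡ L.map (map₂ f) (Ushape one c p p⁺ θ b)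
Ushape-map f one true  p p⁺ q⁺ θ b q⁺≡ = ≡.cong (λ q → (one , q) ∷ (θ , f p) ∷ []) (q⁺≡ ≡.refl)
Ushape-map f one false p p⁺ q⁺ θ b _   = ≡.refl

<ᵇ≡true⇒< : ∀ m n → (m <ᵇ n) ≡ true → m ℕ.< n
<ᵇ≡true⇒< m n m<ᵇn = ℕP.<ᵇ⇒< m n (≡.subst T (≡.sym m<ᵇn) tt)

part-pos⇒< : ∀ λ′ t → 0 ℕ.< part λ′ t → t ℕ.< L.length λ′
part-pos⇒< (x ∷ λ′) zero    _   = s≤s z≤n
part-pos⇒< (x ∷ λ′) (suc t) pos = s≤s (part-pos⇒< λ′ t pos)

addable⇒≤length : ∀ λ′ r → addable λ′ (suc r) ≡ true → r ℕ.≤ L.length λ′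
addable⇒≤length λ′ zero    _   = z≤n
addable⇒≤length λ′ (suc r) add = part-pos⇒< λ′ r (ℕP.≤-trans (s≤s z≤n) (<ᵇ≡true⇒< _ _ add))

part-incr-< : ∀ λ′ s t → s ℕ.< t → part (incr λ′ s) t ≡ part λ′ t
part-incr-< []       s       (suc t) _         = ≡.refl
part-incr-< (x ∷ λ′) zero    (suc t) _         = ≡.refl
part-incr-< (x ∷ λ′) (suc s) (suc t) (s≤s s<t) = part-incr-< λ′ s t s<t

part-incr-> : ∀ λ′ r t → r ℕ.≤ L.length λ′ → t ℕ.< r → part (incr λ′ r) t ≡ part λ′ t
part-incr-> (x ∷ λ′) (suc r) zero    _         _         = ≡.refl
part-incr-> (x ∷ λ′) (suc r) (suc t) (s≤s r≤) (s≤s t<r) = part-incr-> λ′ r t r≤ t<r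

incr-incr : ∀ λ′ s r → s ℕ.< r → r ℕ.≤ L.length λ′ → incr (incr λ′ s) r ≡ incr (incr λ′ r) s
incr-incr (x ∷ λ′) zero    (suc r) _         _        = ≡.refl
incr-incr (x ∷ λ′) (suc s) (suc r) (s≤s s<r) (s≤s r≤) = ≡.cong (x ∷_) (incr-incr λ′ s r s<r r≤)

addable-incr-< : ∀ λ′ s q → s ℕ.< q → addable (incr λ′ s) (suc (suc q)) ≡ addable λ′ (suc (suc q))
addable-incr-< λ′ s q s<q =
  ≡.cong₂ _<ᵇ_ (part-incr-< λ′ s (suc q) (ℕP.m<n⇒m<1+n s<q)) (part-incr-< λ′ s q s<q)

addable-incr-> : ∀ λ′ s r → suc s ℕ.< r → r ℕ.≤ L.length λ′ → addable (incr λ′ r) (suc s) ≡ addable λ′ (suc s)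
addable-incr-> λ′ zero    r _     _  = ≡.refl
addable-incr-> λ′ (suc s) r 2+s<r r≤ =
  ≡.cong₂ _<ᵇ_ (part-incr-> λ′ r (suc s) r≤ 1+s<r) (part-incr-> λ′ r s r≤ (ℕP.<-trans (ℕP.n<1+n s) 1+s<r))
  where
  1+s<r : suc s ℕ.< r
  1+s<r = ℕP.<-trans (ℕP.n<1+n (suc s)) 2+s<r

module FormalSums {c ℓ : Level} (R : CommutativeRing c ℓ) (α β : ℕ → CommutativeRing.Carrier R) where
  open CommutativeRing R
  open CommutativeSemigroupProperties +-commutativeSemigroup using (interchange; x∙yz≈y∙xz)
  module ≈-Reasoning = SetoidReasoning setoid
  open KP R α β

  _≟ₚ_ : (λ′ μ : List ℕ) → Dec (λ′ ≡ μ)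
  _≟ₚ_ = ≡-dec ℕP._≟_

  coeff-∷-≢ : ∀ a {λ′ μ} v → ¬ λ′ ≡ μ → coeff ((a , λ′) ∷ v) μ ≈ coeff v μ
  coeff-∷-≢ a {λ′} {μ} v λ′≢μ rewrite dec-false (λ′ ≟ₚ μ) λ′≢μ = refl

  -- _≈V_ is a Π-type from which Agda cannot recover the two vectors;
  -- boxing it lets the vectors in a transitivity chain be inferred.
  infix 4 _≋_
  record _≋_ (v w : Vec) : Set ℓ where
    constructor box
    field unbox : v ≈V w
  open _≋_ public

  ≋-refl : ∀ {v} → v ≋ v
  ≋-refl = box (λ _ → refl)

  ≋-sym : ∀ {v w} → v ≋ w → w ≋ v
  ≋-sym (box v≈w) = box (λ μ → sym (v≈w μ))

  infixr 5 _⟫_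
  _⟫_ : ∀ {u v w} → u ≋ v → v ≋ w → u ≋ w
  box u≈v ⟫ box v≈w = box (λ μ → trans (u≈v μ) (v≈w μ))

  ≡⇒≋ : ∀ {v w} → v ≡ w → v ≋ w
  ≡⇒≋ ≡.refl = ≋-refl

  scale : Carrier → Vec → Vec
  scale a = L.map (λ p → (a * proj₁ p , proj₂ p))

  coeff-++ : ∀ v w μ → coeff (v ++ w) μ ≈ coeff v μ + coeff w μ
  coeff-++ []             w μ = sym (+-identityˡ _)
  coeff-++ ((a , λ′) ∷ v) w μ with does (λ′ ≟ₚ μ)
  ... | true  = trans (+-congˡ (coeff-++ v w μ)) (sym (+-assoc _ _ _))
  ... | false = coeff-++ v w μ

  coeff-scale : ∀ a w μ → coeff (scale a w) μ ≈ a * coeff w μ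
  coeff-scale a []             μ = sym (zeroʳ a)
  coeff-scale a ((b , λ′) ∷ w) μ with does (λ′ ≟ₚ μ)
  ... | true  = trans (+-congˡ (coeff-scale a w μ)) (sym (distribˡ a b _))
  ... | false = coeff-scale a w μ

  ++-cong : ∀ {v v′ w w′} → v ≋ v′ → w ≋ w′ → v ++ w ≋ v′ ++ w′
  ++-cong {v} {v′} {w} {w′} (box v≈v′) (box w≈w′) = box λ μ → begin
    coeff (v ++ w) μ           ≈⟨ coeff-++ v w μ ⟩
    coeff v μ + coeff w μ      ≈⟨ +-cong (v≈v′ μ) (w≈w′ μ) ⟩
    coeff v′ μ + coeff w′ μ    ≈⟨ coeff-++ v′ w′ μ ⟨
    coeff (v′ ++ w′) μ         ∎
    where open ≈-Reasoning

  ++-interchange : ∀ u v w x → (u ++ v) ++ (w ++ x) ≋ (u ++ w) ++ (v ++ x)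
  ++-interchange u v w x = box λ μ → begin
    coeff ((u ++ v) ++ (w ++ x)) μ                               ≈⟨ coeff-++ (u ++ v) (w ++ x) μ ⟩
    coeff (u ++ v) μ + coeff (w ++ x) μ                          ≈⟨ +-cong (coeff-++ u v μ) (coeff-++ w x μ) ⟩
    (coeff u μ + coeff v μ) + (coeff w μ + coeff x μ)            ≈⟨ interchange _ _ _ _ ⟩
    (coeff u μ + coeff w μ) + (coeff v μ + coeff x μ)            ≈⟨ +-cong (coeff-++ u w μ) (coeff-++ v x μ) ⟨
    coeff (u ++ w) μ + coeff (v ++ x) μ                          ≈⟨ coeff-++ (u ++ w) (v ++ x) μ ⟨
    coeff ((u ++ w) ++ (v ++ x)) μ                               ∎
    where open ≈-Reasoning

  pairing : (List ℕ → Carrier) → Vec → Carrier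
  pairing g []             = 0#
  pairing g ((a , λ′) ∷ v) = a * g λ′ + pairing g v

  coeff-linExt : ∀ f v μ → coeff (linExt f v) μ ≈ pairing (λ λ′ → coeff (f λ′) μ) v
  coeff-linExt f []             μ = refl
  coeff-linExt f ((a , λ′) ∷ v) μ =
    trans (coeff-++ (scale a (f λ′)) (linExt f v) μ)
          (+-cong (coeff-scale a (f λ′) μ) (coeff-linExt f v μ))

  removeAll : List ℕ → Vec → Vec
  removeAll μ []             = []
  removeAll μ ((a , λ′) ∷ v) with λ′ ≟ₚ μ
  ... | yes _ = removeAll μ v
  ... | no  _ = (a , λ′) ∷ removeAll μ v

  pairing-removeAll : ∀ g μ v → pairing g v ≈ coeff v μ * g μ + pairing g (removeAll μ v)
  pairing-removeAll g μ []             = sym (trans (+-identityʳ _) (zeroˡ _))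
  pairing-removeAll g μ ((a , λ′) ∷ v) with λ′ ≟ₚ μ
  ... | yes ≡.refl = begin
    a * g λ′ + pairing g v                                          ≈⟨ +-congˡ (pairing-removeAll g λ′ v) ⟩
    a * g λ′ + (coeff v λ′ * g λ′ + pairing g (removeAll λ′ v))     ≈⟨ +-assoc _ _ _ ⟨
    (a * g λ′ + coeff v λ′ * g λ′) + pairing g (removeAll λ′ v)     ≈⟨ +-congʳ (distribʳ (g λ′) a (coeff v λ′)) ⟨
    (a + coeff v λ′) * g λ′ + pairing g (removeAll λ′ v)            ∎
    where open ≈-Reasoning
  ... | no _ = begin
    a * g λ′ + pairing g v                                          ≈⟨ +-congˡ (pairing-removeAll g μ v) ⟩
    a * g λ′ + (coeff v μ * g μ + pairing g (removeAll μ v))        ≈⟨ x∙yz≈y∙xz _ _ _ ⟩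
    coeff v μ * g μ + (a * g λ′ + pairing g (removeAll μ v))        ∎
    where open ≈-Reasoning

  coeff-removeAll-≡ : ∀ μ v → coeff (removeAll μ v) μ ≈ 0#
  coeff-removeAll-≡ μ []             = refl
  coeff-removeAll-≡ μ ((a , λ′) ∷ v) with λ′ ≟ₚ μ
  ... | yes _   = coeff-removeAll-≡ μ v
  ... | no λ′≢μ = trans (coeff-∷-≢ a (removeAll μ v) λ′≢μ) (coeff-removeAll-≡ μ v)

  coeff-removeAll-≢ : ∀ μ {ν} v → ¬ ν ≡ μ → coeff (removeAll μ v) ν ≈ coeff v ν
  coeff-removeAll-≢ μ     []             ν≢μ = refl
  coeff-removeAll-≢ μ {ν} ((a , λ′) ∷ v) ν≢μ with λ′ ≟ₚ μ
  ... | yes ≡.refl = sym (trans (coeff-∷-≢ a v (ν≢μ ∘ ≡.sym)) (sym (coeff-removeAll-≢ μ v ν≢μ)))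
  ... | no  _      with does (λ′ ≟ₚ ν)
  ...   | true  = +-congˡ (coeff-removeAll-≢ μ v ν≢μ)
  ...   | false = coeff-removeAll-≢ μ v ν≢μ

  removeAll-cong : ∀ μ v w → v ≈V w → removeAll μ v ≈V removeAll μ w
  removeAll-cong μ v w v≈w ν with ν ≟ₚ μ
  ... | yes ≡.refl = trans (coeff-removeAll-≡ μ v) (sym (coeff-removeAll-≡ μ w))
  ... | no  ν≢μ    = trans (coeff-removeAll-≢ μ v ν≢μ) (trans (v≈w ν) (sym (coeff-removeAll-≢ μ w ν≢μ)))

  SupportedIn : List (List ℕ) → Vec → Set c
  SupportedIn D = All (λ p → proj₂ p ∈ D)

  removeAll-supported : ∀ μ D v → SupportedIn (μ ∷ D) v → SupportedIn D (removeAll μ v)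
  removeAll-supported μ D []             []           = []
  removeAll-supported μ D ((a , λ′) ∷ v) (λ′∈ ∷ v⊆) with λ′ ≟ₚ μ | λ′∈
  ... | yes _   | _         = removeAll-supported μ D v v⊆
  ... | no λ′≢μ | here λ′≡μ = ⊥-elim (λ′≢μ λ′≡μ)
  ... | no _    | there λ′∈D = λ′∈D ∷ removeAll-supported μ D v v⊆

  pairing-cong-on : ∀ g D {v w} → SupportedIn D v → SupportedIn D w → v ≈V w →
                    pairing g v ≈ pairing g w
  pairing-cong-on g []      []        []        _   = refl
  pairing-cong-on g []      (() ∷ _)  _         _
  pairing-cong-on g []      []        (() ∷ _)  _
  pairing-cong-on g (μ ∷ D) {v} {w} v⊆ w⊆ v≈w = begin
    pairing g v                                      ≈⟨ pairing-removeAll g μ v ⟩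
    coeff v μ * g μ + pairing g (removeAll μ v)      ≈⟨ +-cong (*-congʳ (v≈w μ)) (pairing-cong-on g D
                                                          (removeAll-supported μ D v v⊆) (removeAll-supported μ D w w⊆)
                                                          (removeAll-cong μ v w v≈w)) ⟩
    coeff w μ * g μ + pairing g (removeAll μ w)      ≈⟨ pairing-removeAll g μ w ⟨
    pairing g w                                      ∎
    where open ≈-Reasoning

  support : Vec → List (List ℕ)
  support = L.map proj₂

  supportedIn-support : ∀ v → SupportedIn (support v) v
  supportedIn-support []      = []
  supportedIn-support (_ ∷ v) = here ≡.refl ∷ All.map there (supportedIn-support v)

  pairing-cong : ∀ g v w → v ≈V w → pairing g v ≈ pairing g w
  pairing-cong g v w = pairing-cong-on g (support v ++ support w)
    (All.map AnyP.++⁺ˡ (supportedIn-support v))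
    (All.map (AnyP.++⁺ʳ (support v)) (supportedIn-support w))

  linExt-cong : ∀ f {v w} → v ≋ w → linExt f v ≋ linExt f w
  linExt-cong f {v} {w} (box v≈w) = box λ μ →
    trans (coeff-linExt f v μ) (trans (pairing-cong _ v w v≈w) (sym (coeff-linExt f w μ)))

  linExt-++ : ∀ f v w → linExt f (v ++ w) ≡ linExt f v ++ linExt f w
  linExt-++ f []             w = ≡.refl
  linExt-++ f ((a , λ′) ∷ v) w =
    ≡.trans (≡.cong (scale a (f λ′) ++_) (linExt-++ f v w))
            (≡.sym (LP.++-assoc (scale a (f λ′)) (linExt f v) (linExt f w)))

  pairing-scale : ∀ g a v → pairing g (scale a v) ≈ a * pairing g v
  pairing-scale g a []             = sym (zeroʳ a)
  pairing-scale g a ((b , λ′) ∷ v) =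
    trans (+-cong (*-assoc a b (g λ′)) (pairing-scale g a v)) (sym (distribˡ a _ _))

  scale-++ : ∀ a v w → scale a (v ++ w) ≡ scale a v ++ scale a w
  scale-++ a = LP.map-++ _

  record IsLinear (O : Vec → Vec) : Set (c ⊔ ℓ) where
    field
      cong       : ∀ {v w} → v ≋ w → O v ≋ O w
      ++-homo    : ∀ v w → O (v ++ w) ≋ O v ++ O w
      scale-homo : ∀ a v → O (scale a v) ≋ scale a (O v)
      []-homo    : O [] ≋ []

  linExt-isLinear : ∀ f → IsLinear (linExt f)
  linExt-isLinear f = record
    { cong       = linExt-cong f
    ; ++-homo    = λ v w → ≡⇒≋ (linExt-++ f v w)
    ; scale-homo = λ a v → box λ μ → begin
        coeff (linExt f (scale a v)) μ                     ≈⟨ coeff-linExt f (scale a v) μ ⟩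
        pairing (λ λ′ → coeff (f λ′) μ) (scale a v)        ≈⟨ pairing-scale _ a v ⟩
        a * pairing (λ λ′ → coeff (f λ′) μ) v              ≈⟨ *-congˡ (coeff-linExt f v μ) ⟨
        a * coeff (linExt f v) μ                           ≈⟨ coeff-scale a (linExt f v) μ ⟨
        coeff (scale a (linExt f v)) μ                     ∎
    ; []-homo    = ≋-refl
    }
    where open ≈-Reasoning

  ∘-isLinear : ∀ {O O′} → IsLinear O → IsLinear O′ → IsLinear (O ∘ O′)
  ∘-isLinear {O} {O′} O-lin O′-lin = record
    { cong       = O.cong ∘ O′.cong
    ; ++-homo    = λ v w → O.cong (O′.++-homo v w) ⟫ O.++-homo (O′ v) (O′ w)
    ; scale-homo = λ a v → O.cong (O′.scale-homo a v) ⟫ O.scale-homo a (O′ v)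
    ; []-homo    = O.cong O′.[]-homo ⟫ O.[]-homo
    }
    where
    module O  = IsLinear O-lin
    module O′ = IsLinear O′-lin

  ⊕-isLinear : ∀ {O O′} → IsLinear O → IsLinear O′ → IsLinear (O ⊕ O′)
  ⊕-isLinear {O} {O′} O-lin O′-lin = record
    { cong       = λ v≋w → ++-cong (O.cong v≋w) (O′.cong v≋w)
    ; ++-homo    = λ v w → ++-cong (O.++-homo v w) (O′.++-homo v w)
                           ⟫ ++-interchange (O v) (O w) (O′ v) (O′ w)
    ; scale-homo = λ a v → ++-cong (O.scale-homo a v) (O′.scale-homo a v)
                           ⟫ ≡⇒≋ (≡.sym (scale-++ a (O v) (O′ v)))
    ; []-homo    = ++-cong O.[]-homo O′.[]-homo
    }
    where
    module O  = IsLinear O-lin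
    module O′ = IsLinear O′-lin

  basis : List ℕ → Vec
  basis λ′ = [ (1# , λ′) ]

  scale-basis : ∀ a λ′ → [ (a , λ′) ] ≋ scale a (basis λ′)
  scale-basis a λ′ = box same-coeff
    where
    same-coeff : [ (a , λ′) ] ≈V scale a (basis λ′)
    same-coeff μ with does (λ′ ≟ₚ μ)
    ... | true  = +-congʳ (sym (*-identityʳ a))
    ... | false = refl

  linExt-basis-expansion : ∀ {O} → IsLinear O → ∀ v → O v ≋ linExt (O ∘ basis) v
  linExt-basis-expansion {O} O-lin []             = []-homo
    where open IsLinear O-lin
  linExt-basis-expansion {O} O-lin ((a , λ′) ∷ v) =
    ++-homo [ (a , λ′) ] v
    ⟫ ++-cong (cong (scale-basis a λ′) ⟫ scale-homo a (basis λ′)) (linExt-basis-expansion O-lin v)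
    where open IsLinear O-lin

  linExt-cong-on : ∀ (Q : List ℕ → Set) f g → (∀ λ′ → Q λ′ → f λ′ ≋ g λ′) →
                   ∀ v → All (Q ∘ proj₂) v → linExt f v ≋ linExt g v
  linExt-cong-on Q f g f≋g []             []          = ≋-refl
  linExt-cong-on Q f g f≋g ((a , λ′) ∷ v) (Qλ′ ∷ Qv) =
    ++-cong (box λ μ → trans (coeff-scale a (f λ′) μ)
                      (trans (*-congˡ (unbox (f≋g λ′ Qλ′) μ)) (sym (coeff-scale a (g λ′) μ))))
            (linExt-cong-on Q f g f≋g v Qv)

  linear-ext : ∀ (Q : List ℕ → Set) {O O′} → IsLinear O → IsLinear O′ →
               (∀ λ′ → Q λ′ → O (basis λ′) ≋ O′ (basis λ′)) →
               ∀ v → All (Q ∘ proj₂) v → O v ≋ O′ v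
  linear-ext Q {O} {O′} O-lin O′-lin agree v Qv =
    linExt-basis-expansion O-lin v
    ⟫ linExt-cong-on Q (O ∘ basis) (O′ ∘ basis) agree v Qv
    ⟫ ≋-sym (linExt-basis-expansion O′-lin v)

  δ : List ℕ → List ℕ → Carrier
  δ λ′ μ = if does (λ′ ≟ₚ μ) then 1# else 0#

  coeff≈pairing-δ : ∀ w μ → coeff w μ ≈ pairing (λ λ′ → δ λ′ μ) w
  coeff≈pairing-δ []             μ = refl
  coeff≈pairing-δ ((a , λ′) ∷ w) μ with does (λ′ ≟ₚ μ)
  ... | true  = +-cong (sym (*-identityʳ a)) (coeff≈pairing-δ w μ)
  ... | false = trans (coeff≈pairing-δ w μ) (sym (trans (+-congʳ (zeroʳ a)) (+-identityˡ _)))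

  -- Comparing pairings with δ leaves the ring solver with the δ's as atoms.
  ≋-by-δ : ∀ v w → (∀ μ → pairing (λ λ′ → δ λ′ μ) v ≈ pairing (λ λ′ → δ λ′ μ) w) → v ≋ w
  ≋-by-δ v w eq = box λ μ → trans (coeff≈pairing-δ v μ) (trans (eq μ) (sym (coeff≈pairing-δ w μ)))

Cell : Set
Cell = ℕ × ℕ

addableᵢ : Maybe ℕ → ℕ → Bool
addableᵢ nothing  x = true
addableᵢ (just g) x = x <ᵇ g

addableᵢ₊₁ : ℕ → ℕ → ℕ → Bool
addableᵢ₊₁ g₂ x y = y <ᵇ g₂ ℕ.+ x

BelowGap : Maybe ℕ → ℕ → Set
BelowGap nothing  x = ⊤
BelowGap (just g) x = x ℕ.≤ g

BelowGap-zero : ∀ g → BelowGap g 0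
BelowGap-zero nothing  = tt
BelowGap-zero (just _) = z≤n

BelowGap-suc : ∀ g x → BelowGap g x → addableᵢ g x ≡ true → BelowGap g (suc x)
BelowGap-suc nothing  x _ _   = tt
BelowGap-suc (just g) x _ x<g = <ᵇ≡true⇒< x g x<g

Reachable : Maybe ℕ → ℕ → Cell → Set
Reachable g₁ g₂ (x , y) = BelowGap g₁ x × y ℕ.≤ g₂ ℕ.+ x

-- U_i and U_{i+1} on cells, over any coefficient type, so that it runs both in R
-- and in the ring solver's polynomial syntax.
module LocalModel {t} {T : Set t} (one : T) (_·_ : T → T → T)
                  (θᵢ θᵢ₊₁ : ℕ → T) (bᵢ bᵢ₊₁ : T) (g₁ : Maybe ℕ) (g₂ : ℕ) where

  Sum : Set t
  Sum = List (T × Cell)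

  scaleᶜ : T → Sum → Sum
  scaleᶜ a = L.map (λ q → (a · proj₁ q , proj₂ q))

  linExtᶜ : (Cell → Sum) → Sum → Sum
  linExtᶜ f []            = []
  linExtᶜ f ((a , p) ∷ w) = scaleᶜ a (f p) ++ linExtᶜ f w

  Uᵢ-cell : Cell → Sum
  Uᵢ-cell (x , y) = Ushape one (addableᵢ g₁ x) (x , y) (suc x , y) (θᵢ x) bᵢ

  Uᵢ₊₁-cell : Cell → Sum
  Uᵢ₊₁-cell (x , y) = Ushape one (addableᵢ₊₁ g₂ x y) (x , y) (x , suc y) (θᵢ₊₁ y) bᵢ₊₁

  Uᵢᶜ : Sum → Sum
  Uᵢᶜ = linExtᶜ Uᵢ-cell

  Uᵢ₊₁ᶜ : Sum → Sum
  Uᵢ₊₁ᶜ = linExtᶜ Uᵢ₊₁-cell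

  origin : Sum
  origin = [ (one , (0 , 0)) ]

  lhs : Sum
  lhs = Uᵢᶜ (Uᵢ₊₁ᶜ (Uᵢᶜ origin)) ++ Uᵢ₊₁ᶜ (Uᵢ₊₁ᶜ (Uᵢᶜ origin))

  rhs : Sum
  rhs = Uᵢ₊₁ᶜ (Uᵢᶜ (Uᵢᶜ origin ++ Uᵢ₊₁ᶜ origin))

  Reachableᶜ : T × Cell → Set
  Reachableᶜ q = Reachable g₁ g₂ (proj₂ q)

  linExtᶜ-reachable : ∀ f → (∀ p → Reachable g₁ g₂ p → All Reachableᶜ (f p)) →
                      ∀ w → All Reachableᶜ w → All Reachableᶜ (linExtᶜ f w)
  linExtᶜ-reachable f f-reach []            []             = []
  linExtᶜ-reachable f f-reach ((a , p) ∷ w) (p-reach ∷ w-reach) =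
    AllP.++⁺ (AllP.map⁺ (f-reach p p-reach)) (linExtᶜ-reachable f f-reach w w-reach)

  Uᵢᶜ-reachable : ∀ w → All Reachableᶜ w → All Reachableᶜ (Uᵢᶜ w)
  Uᵢᶜ-reachable = linExtᶜ-reachable Uᵢ-cell step
    where
    step : ∀ p → Reachable g₁ g₂ p → All Reachableᶜ (Uᵢ-cell p)
    step (x , y) (x≤ , y≤) with addableᵢ g₁ x in add
    ... | false = (x≤ , y≤) ∷ []
    ... | true  = (BelowGap-suc g₁ x x≤ add , ℕP.≤-trans y≤ (ℕP.+-monoʳ-≤ g₂ (ℕP.n≤1+n x))) ∷ (x≤ , y≤) ∷ []

  Uᵢ₊₁ᶜ-reachable : ∀ w → All Reachableᶜ w → All Reachableᶜ (Uᵢ₊₁ᶜ w)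
  Uᵢ₊₁ᶜ-reachable = linExtᶜ-reachable Uᵢ₊₁-cell step
    where
    step : ∀ p → Reachable g₁ g₂ p → All Reachableᶜ (Uᵢ₊₁-cell p)
    step (x , y) (x≤ , y≤) with addableᵢ₊₁ g₂ x y in add
    ... | false = (x≤ , y≤) ∷ []
    ... | true  = (x≤ , <ᵇ≡true⇒< y (g₂ ℕ.+ x) add) ∷ (x≤ , y≤) ∷ []

-- A chart of λ′ around the rows i = r + 1 and i + 1: cell (x , y) is λ′ with x boxes
-- added to row i and y to row i + 1, g₁ = λ_{i-1} − λ_i (nothing for i = 1) and
-- g₂ = λ_i − λ_{i+1}.
record Chart (r : ℕ) (λ′ : List ℕ) : Set where
  field
    g₁          : Maybe ℕ
    g₂ λᵢ₊₁     : ℕ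
    cell        : Cell → List ℕ
    cell-origin : cell (0 , 0) ≡ λ′
    addable-i   : ∀ x y → Reachable g₁ g₂ (x , y) → addable (cell (x , y)) (suc r) ≡ addableᵢ g₁ x
    addable-i+1 : ∀ x y → Reachable g₁ g₂ (x , y) → addable (cell (x , y)) (suc (suc r)) ≡ addableᵢ₊₁ g₂ x y
    part-i      : ∀ x y → Reachable g₁ g₂ (x , y) → part (cell (x , y)) r ≡ x ℕ.+ (g₂ ℕ.+ λᵢ₊₁)
    part-i+1    : ∀ x y → Reachable g₁ g₂ (x , y) → part (cell (x , y)) (suc r) ≡ y ℕ.+ λᵢ₊₁
    incr-i      : ∀ x y → Reachable g₁ g₂ (x , y) → addableᵢ g₁ x ≡ true →
                  incr (cell (x , y)) r ≡ cell (suc x , y)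
    incr-i+1    : ∀ x y → Reachable g₁ g₂ (x , y) → addableᵢ₊₁ g₂ x y ≡ true →
                  incr (cell (x , y)) (suc r) ≡ cell (x , suc y)

part-suc-≤ : ∀ λ′ → Linked (λ a b → b ℕ.≤ a) λ′ → ∀ t → part λ′ (suc t) ℕ.≤ part λ′ t
part-suc-≤ []          _         t       = z≤n
part-suc-≤ (x ∷ [])    _         t       = z≤n
part-suc-≤ (x ∷ y ∷ λ′) (y≤x ∷ _) zero    = y≤x
part-suc-≤ (x ∷ y ∷ λ′) (_ ∷ l)   (suc t) = part-suc-≤ (y ∷ λ′) l t

<ᵇ-+ʳ : ∀ m n k → (m ℕ.+ k <ᵇ n ℕ.+ k) ≡ (m <ᵇ n)
<ᵇ-+ʳ m n k rewrite ℕP.+-comm m k | ℕP.+-comm n k = <ᵇ-+ˡ k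
  where
  <ᵇ-+ˡ : ∀ k → (k ℕ.+ m <ᵇ k ℕ.+ n) ≡ (m <ᵇ n)
  <ᵇ-+ˡ zero    = ≡.refl
  <ᵇ-+ˡ (suc k) = <ᵇ-+ˡ k

addableᵢ₊₁-shift : ∀ x y g₂ c → (y ℕ.+ c <ᵇ x ℕ.+ (g₂ ℕ.+ c)) ≡ addableᵢ₊₁ g₂ x y
addableᵢ₊₁-shift x y g₂ c =
  ≡.trans (≡.cong (y ℕ.+ c <ᵇ_) (≡.trans (≡.sym (ℕP.+-assoc x g₂ c)) (≡.cong (ℕ._+ c) (ℕP.+-comm x g₂))))
          (<ᵇ-+ʳ y (g₂ ℕ.+ x) c)

addableᵢ₊₁⇒< : ∀ x y g₂ c → addableᵢ₊₁ g₂ x y ≡ true → y ℕ.+ c ℕ.< x ℕ.+ (g₂ ℕ.+ c)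
addableᵢ₊₁⇒< x y g₂ c add = <ᵇ≡true⇒< _ _ (≡.trans (addableᵢ₊₁-shift x y g₂ c) add)

-- Rows u ≥ v on top of rest; when rest = [] zero rows are dropped, as partitions
-- carry no zero parts.
twoRows : ℕ → ℕ → List ℕ → List ℕ
twoRows u       v       (h ∷ t) = u ∷ v ∷ h ∷ t
twoRows u       (suc v) []      = u ∷ suc v ∷ []
twoRows zero    zero    []      = []
twoRows (suc u) zero    []      = suc u ∷ []

part-twoRows-0 : ∀ u v rest → part (twoRows u v rest) 0 ≡ u
part-twoRows-0 u       v       (h ∷ t) = ≡.refl
part-twoRows-0 zero    zero    []      = ≡.refl
part-twoRows-0 (suc u) zero    []      = ≡.refl
part-twoRows-0 u       (suc v) []      = ≡.refl

part-twoRows-1 : ∀ u v rest → part (twoRows u v rest) 1 ≡ v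
part-twoRows-1 u       v       (h ∷ t) = ≡.refl
part-twoRows-1 zero    zero    []      = ≡.refl
part-twoRows-1 (suc u) zero    []      = ≡.refl
part-twoRows-1 u       (suc v) []      = ≡.refl

incr-twoRows-0 : ∀ u v rest → incr (twoRows u v rest) 0 ≡ twoRows (suc u) v rest
incr-twoRows-0 u       v       (h ∷ t) = ≡.refl
incr-twoRows-0 zero    zero    []      = ≡.refl
incr-twoRows-0 (suc u) zero    []      = ≡.refl
incr-twoRows-0 u       (suc v) []      = ≡.refl

incr-twoRows-1 : ∀ u v rest → v ℕ.< u → incr (twoRows u v rest) 1 ≡ twoRows u (suc v) rest
incr-twoRows-1 u       v       (h ∷ t) _ = ≡.refl
incr-twoRows-1 (suc u) zero    []      _ = ≡.refl
incr-twoRows-1 u       (suc v) []      _ = ≡.refl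

twoRows-part-drop : ∀ λ′ → All (1 ℕ.≤_) λ′ → twoRows (part λ′ 0) (part λ′ 1) (L.drop 2 λ′) ≡ λ′
twoRows-part-drop []               _            = ≡.refl
twoRows-part-drop (suc u ∷ [])     _            = ≡.refl
twoRows-part-drop (u ∷ suc v ∷ []) _            = ≡.refl
twoRows-part-drop (u ∷ v ∷ h ∷ t)  _            = ≡.refl
twoRows-part-drop (zero ∷ [])      (() ∷ _)
twoRows-part-drop (u ∷ zero ∷ [])  (_ ∷ () ∷ _)

part-++-length : ∀ pre λ′ t → part (pre ++ λ′) (t ℕ.+ L.length pre) ≡ part λ′ t
part-++-length []        λ′ t rewrite ℕP.+-identityʳ t = ≡.refl
part-++-length (x ∷ pre) λ′ t rewrite ℕP.+-suc t (L.length pre) = part-++-length pre λ′ t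

part-++-< : ∀ pre λ′ t → t ℕ.< L.length pre → part (pre ++ λ′) t ≡ part pre t
part-++-< (x ∷ pre) λ′ zero    _         = ≡.refl
part-++-< (x ∷ pre) λ′ (suc t) (s≤s t<) = part-++-< pre λ′ t t<

incr-++-length : ∀ pre λ′ t → incr (pre ++ λ′) (t ℕ.+ L.length pre) ≡ pre ++ incr λ′ t
incr-++-length []        λ′ t rewrite ℕP.+-identityʳ t = ≡.refl
incr-++-length (x ∷ pre) λ′ t rewrite ℕP.+-suc t (L.length pre) = ≡.cong (x ∷_) (incr-++-length pre λ′ t)

split-at : ∀ (xs : List ℕ) r → r ℕ.≤ L.length xs →
           Σ (List ℕ) λ pre → Σ (List ℕ) λ suf → xs ≡ pre ++ suf × L.length pre ≡ r
split-at xs       zero    _       = [] , xs , ≡.refl , ≡.refl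
split-at (x ∷ xs) (suc r) (s≤s r≤) with split-at xs r r≤
... | pre , suf , xs≡ , len≡ = x ∷ pre , suf , ≡.cong (x ∷_) xs≡ , ≡.cong suc len≡

chart-first : ∀ λ′ → All (1 ℕ.≤_) λ′ → part λ′ 1 ℕ.≤ part λ′ 0 → Chart 0 λ′
chart-first λ′ pos λ₂≤λ₁ = record
  { g₁ = nothing ; g₂ = g₂ ; λᵢ₊₁ = c ; cell = cell
  ; cell-origin = ≡.trans (≡.cong (λ u → twoRows u c rest) g₂+c≡) (twoRows-part-drop λ′ pos)
  ; addable-i   = λ x y _ → ≡.refl
  ; addable-i+1 = λ x y _ → ≡.trans (≡.cong₂ _<ᵇ_ (part-twoRows-1 _ _ rest) (part-twoRows-0 _ _ rest))
                                    (addableᵢ₊₁-shift x y g₂ c)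
  ; part-i      = λ x y _ → part-twoRows-0 _ _ rest
  ; part-i+1    = λ x y _ → part-twoRows-1 _ _ rest
  ; incr-i      = λ x y _ _ → incr-twoRows-0 _ _ rest
  ; incr-i+1    = λ x y _ add → incr-twoRows-1 _ _ rest (addableᵢ₊₁⇒< x y g₂ c add)
  }
  where
  c    = part λ′ 1
  g₂   = part λ′ 0 ℕ.∸ c
  rest = L.drop 2 λ′
  g₂+c≡ : g₂ ℕ.+ c ≡ part λ′ 0
  g₂+c≡ = ℕP.m∸n+n≡m λ₂≤λ₁
  cell : Cell → List ℕ
  cell (x , y) = twoRows (x ℕ.+ (g₂ ℕ.+ c)) (y ℕ.+ c) rest

-- When row i − 1 is empty, rows i and i + 1 are empty and neither is addable,
-- so (0 , 0) is the only reachable cell.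
chart-empty : ∀ r λ′ → part λ′ r ≡ 0 → Linked (λ a b → b ℕ.≤ a) λ′ → Chart (suc r) λ′
chart-empty r λ′ λᵣ≡0 decr = record
  { g₁ = just 0 ; g₂ = 0 ; λᵢ₊₁ = 0 ; cell = λ _ → λ′
  ; cell-origin = ≡.refl
  ; addable-i   = λ { .0 .0 (z≤n , z≤n) → ≡.cong (part λ′ (suc r) <ᵇ_) λᵣ≡0 }
  ; addable-i+1 = λ { .0 .0 (z≤n , z≤n) → ≡.cong (part λ′ (suc (suc r)) <ᵇ_) λᵢ≡0 }
  ; part-i      = λ { .0 .0 (z≤n , z≤n) → λᵢ≡0 }
  ; part-i+1    = λ { .0 .0 (z≤n , z≤n) → λᵢ₊₁≡0 }
  ; incr-i      = λ { .0 .0 (z≤n , z≤n) () }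
  ; incr-i+1    = λ { .0 .0 (z≤n , z≤n) () }
  }
  where
  below-zero : ∀ t → part λ′ t ≡ 0 → part λ′ (suc t) ≡ 0
  below-zero t λₜ≡0 = ℕP.n≤0⇒n≡0 (≡.subst (part λ′ (suc t) ℕ.≤_) λₜ≡0 (part-suc-≤ λ′ decr t))
  λᵢ≡0   = below-zero r λᵣ≡0
  λᵢ₊₁≡0 = below-zero (suc r) λᵢ≡0

chart-inner : ∀ x₀ pre suf → All (1 ℕ.≤_) suf → part suf 1 ℕ.≤ part suf 0 →
              part suf 0 ℕ.≤ part (x₀ ∷ pre) (L.length pre) →
              Chart (suc (L.length pre)) ((x₀ ∷ pre) ++ suf)
chart-inner x₀ pre suf pos λᵢ₊₁≤λᵢ λᵢ≤λᵢ₋₁ = record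
  { g₁ = just g₁ ; g₂ = g₂ ; λᵢ₊₁ = c ; cell = cell
  ; cell-origin = ≡.cong (top ++_) (≡.trans (≡.cong (λ u → twoRows u c rest) g₂+c≡) (twoRows-part-drop suf pos))
  ; addable-i   = λ x y _ → ≡.trans (≡.cong₂ _<ᵇ_ (≡.trans (part-++-length top (bottom x y) 0) (part-twoRows-0 _ _ rest))
                                                  (≡.trans (part-++-< top (bottom x y) n (ℕP.n<1+n n)) (≡.sym g₁+b≡)))
                                    (≡.trans (≡.cong (λ u → x ℕ.+ u <ᵇ g₁ ℕ.+ b) g₂+c≡) (<ᵇ-+ʳ x g₁ b))
  ; addable-i+1 = λ x y _ → ≡.trans (≡.cong₂ _<ᵇ_ (≡.trans (part-++-length top (bottom x y) 1) (part-twoRows-1 _ _ rest))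
                                                  (≡.trans (part-++-length top (bottom x y) 0) (part-twoRows-0 _ _ rest)))
                                    (addableᵢ₊₁-shift x y g₂ c)
  ; part-i      = λ x y _ → ≡.trans (part-++-length top (bottom x y) 0) (part-twoRows-0 _ _ rest)
  ; part-i+1    = λ x y _ → ≡.trans (part-++-length top (bottom x y) 1) (part-twoRows-1 _ _ rest)
  ; incr-i      = λ x y _ _ → ≡.trans (incr-++-length top (bottom x y) 0) (≡.cong (top ++_) (incr-twoRows-0 _ _ rest))
  ; incr-i+1    = λ x y _ add → ≡.trans (incr-++-length top (bottom x y) 1)
                                        (≡.cong (top ++_) (incr-twoRows-1 _ _ rest (addableᵢ₊₁⇒< x y g₂ c add)))
  }
  where
  top  = x₀ ∷ pre
  n    = L.length pre
  b    = part suf 0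
  c    = part suf 1
  rest = L.drop 2 suf
  g₁   = part top n ℕ.∸ b
  g₂   = b ℕ.∸ c
  g₁+b≡ : g₁ ℕ.+ b ≡ part top n
  g₁+b≡ = ℕP.m∸n+n≡m λᵢ≤λᵢ₋₁
  g₂+c≡ : g₂ ℕ.+ c ≡ b
  g₂+c≡ = ℕP.m∸n+n≡m λᵢ₊₁≤λᵢ
  bottom : ℕ → ℕ → List ℕ
  bottom x y = twoRows (x ℕ.+ (g₂ ℕ.+ c)) (y ℕ.+ c) rest
  cell : Cell → List ℕ
  cell (x , y) = top ++ bottom x y

chart : ∀ r λ′ → IsPartition λ′ → Chart r λ′
chart zero    λ′ (pos , decr) = chart-first λ′ pos (part-suc-≤ λ′ decr 0)
chart (suc r) λ′ (pos , decr) with part λ′ r in λᵣ≡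
... | zero  = chart-empty r λ′ λᵣ≡ decr
... | suc _ with split-at λ′ (suc r) (part-pos⇒< λ′ r (≡.subst (0 ℕ.<_) (≡.sym λᵣ≡) (s≤s z≤n)))
...   | [] , suf , _ , ()
...   | x₀ ∷ pre , suf , ≡.refl , ≡.refl =
  chart-inner x₀ pre suf (AllP.++⁻ʳ (x₀ ∷ pre) pos)
    (≡.subst₂ ℕ._≤_ (part-++-length (x₀ ∷ pre) suf 1) (part-++-length (x₀ ∷ pre) suf 0) (part-suc-≤ _ decr (suc n)))
    (≡.subst₂ ℕ._≤_ (part-++-length (x₀ ∷ pre) suf 0) (part-++-< (x₀ ∷ pre) suf n (ℕP.n<1+n n)) (part-suc-≤ _ decr n))
  where n = L.length pre

module KnuthRelations {c ℓ : Level} (R : CommutativeRing c ℓ) (α β : ℕ → CommutativeRing.Carrier R) where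
  open CommutativeRing R
  open KP R α β
  open FormalSums R α β
  open import Algebra.Solver.Ring.NaturalCoefficients.Default commutativeSemiring

  Uᵇ : ℕ → List ℕ → Vec
  Uᵇ i λ′ = κb i λ′ ++ Θb i λ′

  U-isLinear : ∀ i → IsLinear (U i)
  U-isLinear i = linExt-isLinear (Uᵇ i)

  Uᵇ-shape : ∀ r λ′ → Uᵇ (suc r) λ′ ≡ Ushape 1# (addable λ′ (suc r)) λ′ (incr λ′ r) (- α (part λ′ r)) (β r)
  Uᵇ-shape r λ′ with addable λ′ (suc r)
  ... | true  = ≡.refl
  ... | false = ≡.refl

  U-single : ∀ r a λ′ {b θ} → addable λ′ (suc r) ≡ b → - α (part λ′ r) ≡ θ →
             U (suc r) [ (a , λ′) ] ≋ scale a (Ushape 1# b λ′ (incr λ′ r) θ (β r))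
  U-single r a λ′ ≡.refl ≡.refl =
    ≡⇒≋ (≡.trans (≡.cong (λ w → scale a w ++ []) (Uᵇ-shape r λ′)) (LP.++-identityʳ _))

  U-pair : ∀ r a₁ λ₁ a₂ λ₂ {b₁ θ₁ b₂ θ₂} →
           addable λ₁ (suc r) ≡ b₁ → - α (part λ₁ r) ≡ θ₁ →
           addable λ₂ (suc r) ≡ b₂ → - α (part λ₂ r) ≡ θ₂ →
           U (suc r) ((a₁ , λ₁) ∷ (a₂ , λ₂) ∷ []) ≋
             scale a₁ (Ushape 1# b₁ λ₁ (incr λ₁ r) θ₁ (β r)) ++ scale a₂ (Ushape 1# b₂ λ₂ (incr λ₂ r) θ₂ (β r))
  U-pair r a₁ λ₁ a₂ λ₂ b₁≡ θ₁≡ b₂≡ θ₂≡ =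
    ++-cong (≡⇒≋ (≡.sym (LP.++-identityʳ _)) ⟫ U-single r a₁ λ₁ b₁≡ θ₁≡) (U-single r a₂ λ₂ b₂≡ θ₂≡)

  rearrange₄ : ∀ θₖ θᵢ dₖᵢ dᵢₖ dₖ dᵢ d → dₖᵢ ≡ dᵢₖ →
    ((1# * 1#) * 1#) * dₖᵢ + (((1# * 1#) * θᵢ) * dₖ + (((1# * θₖ) * 1#) * dᵢ + (((1# * θₖ) * θᵢ) * d + 0#)))
    ≈ ((1# * 1#) * 1#) * dᵢₖ + (((1# * 1#) * θₖ) * dᵢ + (((1# * θᵢ) * 1#) * dₖ + (((1# * θᵢ) * θₖ) * d + 0#)))
  rearrange₄ θₖ θᵢ dₖᵢ _ dₖ dᵢ d ≡.refl = solve 6 (λ θₖ θᵢ dₖᵢ dₖ dᵢ d →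
    ((con 1 :* con 1) :* con 1) :* dₖᵢ :+ (((con 1 :* con 1) :* θᵢ) :* dₖ
      :+ (((con 1 :* θₖ) :* con 1) :* dᵢ :+ (((con 1 :* θₖ) :* θᵢ) :* d :+ con 0)))
    := ((con 1 :* con 1) :* con 1) :* dₖᵢ :+ (((con 1 :* con 1) :* θₖ) :* dᵢ
      :+ (((con 1 :* θᵢ) :* con 1) :* dₖ :+ (((con 1 :* θᵢ) :* θₖ) :* d :+ con 0))))
    refl θₖ θᵢ dₖᵢ dₖ dᵢ d

  rearrange₂ : ∀ θ b d₊ d →
    ((1# * 1#) * b) * d₊ + (((1# * θ) * b) * d + 0#) ≈ ((1# * b) * 1#) * d₊ + (((1# * b) * θ) * d + 0#)
  rearrange₂ = solve 4 (λ θ b d₊ d →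
    ((con 1 :* con 1) :* b) :* d₊ :+ (((con 1 :* θ) :* b) :* d :+ con 0)
    := ((con 1 :* b) :* con 1) :* d₊ :+ (((con 1 :* b) :* θ) :* d :+ con 0)) refl

  rearrange₁ : ∀ bₖ bᵢ d → ((1# * bₖ) * bᵢ) * d + 0# ≈ ((1# * bᵢ) * bₖ) * d + 0#
  rearrange₁ = solve 3 (λ bₖ bᵢ d → ((con 1 :* bₖ) :* bᵢ) :* d :+ con 0 := ((con 1 :* bᵢ) :* bₖ) :* d :+ con 0) refl

  U-comm-basis : ∀ q s → s ℕ.< q → ∀ λ′ →
                 U (suc (suc q)) (U (suc s) (basis λ′)) ≋ U (suc s) (U (suc (suc q)) (basis λ′))
  U-comm-basis q s s<q λ′ = by-cases (addable λ′ k) ≡.refl (addable λ′ i) ≡.refl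
    where
    r = suc q
    i = suc r
    k = suc s
    s<r : s ℕ.< r
    s<r = ℕP.m<n⇒m<1+n s<q
    by-cases : ∀ bₖ → addable λ′ k ≡ bₖ → ∀ bᵢ → addable λ′ i ≡ bᵢ →
               U i (U k (basis λ′)) ≋ U k (U i (basis λ′))
    by-cases true eₖ true eᵢ =
      linExt-cong (Uᵇ i) (U-single s 1# λ′ eₖ ≡.refl)
      ⟫ U-pair r _ (incr λ′ s) _ λ′ (≡.trans (addable-incr-< λ′ s q s<q) eᵢ)
               (≡.cong (-_ ∘ α) (part-incr-< λ′ s r s<r)) eᵢ ≡.refl
      ⟫ ≋-by-δ _ _ (λ μ → rearrange₄ _ _ _ _ _ _ _ (≡.cong (λ ν → δ ν μ) (incr-incr λ′ s r s<r r≤len)))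
      ⟫ ≋-sym (linExt-cong (Uᵇ k) (U-single r 1# λ′ eᵢ ≡.refl)
               ⟫ U-pair s _ (incr λ′ r) _ λ′ (≡.trans (addable-incr-> λ′ s r (s≤s s<q) r≤len) eₖ)
                        (≡.cong (-_ ∘ α) (part-incr-> λ′ r s r≤len s<r)) eₖ ≡.refl)
      where
      r≤len = addable⇒≤length λ′ r eᵢ
    by-cases true eₖ false eᵢ =
      linExt-cong (Uᵇ i) (U-single s 1# λ′ eₖ ≡.refl)
      ⟫ U-pair r _ (incr λ′ s) _ λ′ (≡.trans (addable-incr-< λ′ s q s<q) eᵢ) ≡.refl eᵢ ≡.refl
      ⟫ ≋-by-δ _ _ (λ μ → rearrange₂ _ _ _ _)
      ⟫ ≋-sym (linExt-cong (Uᵇ k) (U-single r 1# λ′ eᵢ ≡.refl) ⟫ U-single s _ λ′ eₖ ≡.refl)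
    by-cases false eₖ true eᵢ =
      linExt-cong (Uᵇ i) (U-single s 1# λ′ eₖ ≡.refl)
      ⟫ U-single r _ λ′ eᵢ ≡.refl
      ⟫ ≋-by-δ _ _ (λ μ → sym (rearrange₂ _ _ _ _))
      ⟫ ≋-sym (linExt-cong (Uᵇ k) (U-single r 1# λ′ eᵢ ≡.refl)
               ⟫ U-pair s _ (incr λ′ r) _ λ′
                        (≡.trans (addable-incr-> λ′ s r (s≤s s<q) (addable⇒≤length λ′ r eᵢ)) eₖ) ≡.refl eₖ ≡.refl)
    by-cases false eₖ false eᵢ =
      linExt-cong (Uᵇ i) (U-single s 1# λ′ eₖ ≡.refl)
      ⟫ U-single r _ λ′ eᵢ ≡.refl
      ⟫ ≋-by-δ _ _ (λ μ → rearrange₁ _ _ _)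
      ⟫ ≋-sym (linExt-cong (Uᵇ k) (U-single r 1# λ′ eᵢ ≡.refl) ⟫ U-single s _ λ′ eₖ ≡.refl)

  U-comm : ∀ i k → 1 ℕ.≤ k → 2 ℕ.+ k ℕ.≤ i → ∀ v → U i (U k v) ≋ U k (U i v)
  U-comm i             zero    ()
  U-comm zero          (suc s) _ ()
  U-comm (suc zero)    (suc s) _ (s≤s ())
  U-comm (suc (suc q)) (suc s) _ (s≤s (s≤s s<q)) v =
    linear-ext (λ _ → ⊤) (∘-isLinear (U-isLinear (suc (suc q))) (U-isLinear (suc s)))
                         (∘-isLinear (U-isLinear (suc s)) (U-isLinear (suc (suc q))))
               (λ λ′ _ → U-comm-basis q s s<q λ′) v (All.universal (λ _ → tt) v)

  θᵢ : ℕ → ℕ → ℕ → Carrier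
  θᵢ g₂ c x = - α (x ℕ.+ (g₂ ℕ.+ c))

  θᵢ₊₁ : ℕ → ℕ → Carrier
  θᵢ₊₁ c y = - α (y ℕ.+ c)

  module Model (r : ℕ) (g₁ : Maybe ℕ) (g₂ c : ℕ) =
    LocalModel 1# _*_ (θᵢ g₂ c) (θᵢ₊₁ c) (β r) (β (suc r)) g₁ g₂

  embed : (Cell → List ℕ) → List (Carrier × Cell) → Vec
  embed cell = L.map (map₂ cell)

  module ChartEmbedding {r λ′} (χ : Chart r λ′) where
    open Chart χ
    open Model r g₁ g₂ λᵢ₊₁

    scale-embed : ∀ a w → scale a (embed cell w) ≡ embed cell (scaleᶜ a w)
    scale-embed a w = ≡.trans (≡.sym (LP.map-∘ w)) (LP.map-∘ w)

    U-embed : ∀ i f → (∀ p → Reachable g₁ g₂ p → Uᵇ i (cell p) ≡ embed cell (f p)) →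
              ∀ w → All Reachableᶜ w → U i (embed cell w) ≡ embed cell (linExtᶜ f w)
    U-embed i f f≡ []            []                  = ≡.refl
    U-embed i f f≡ ((a , p) ∷ w) (p-reach ∷ w-reach) =
      ≡.trans (≡.cong₂ _++_ (≡.trans (≡.cong (scale a) (f≡ p p-reach)) (scale-embed a (f p)))
                            (U-embed i f f≡ w w-reach))
              (≡.sym (LP.map-++ _ (scaleᶜ a (f p)) (linExtᶜ f w)))

    Uᵢ-embed : ∀ w → All Reachableᶜ w → U (suc r) (embed cell w) ≡ embed cell (Uᵢᶜ w)
    Uᵢ-embed = U-embed (suc r) Uᵢ-cell on-cell
      where
      on-cell : ∀ p → Reachable g₁ g₂ p → Uᵇ (suc r) (cell p) ≡ embed cell (Uᵢ-cell p)
      on-cell (x , y) reach =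
        ≡.trans (Uᵇ-shape r (cell (x , y)))
       (≡.trans (≡.cong₂ (λ b θ → Ushape 1# b (cell (x , y)) (incr (cell (x , y)) r) θ (β r))
                         (addable-i x y reach) (≡.cong (-_ ∘ α) (part-i x y reach)))
                (Ushape-map cell 1# _ _ _ _ _ _ (incr-i x y reach)))

    Uᵢ₊₁-embed : ∀ w → All Reachableᶜ w → U (suc (suc r)) (embed cell w) ≡ embed cell (Uᵢ₊₁ᶜ w)
    Uᵢ₊₁-embed = U-embed (suc (suc r)) Uᵢ₊₁-cell on-cell
      where
      on-cell : ∀ p → Reachable g₁ g₂ p → Uᵇ (suc (suc r)) (cell p) ≡ embed cell (Uᵢ₊₁-cell p)
      on-cell (x , y) reach =
        ≡.trans (Uᵇ-shape (suc r) (cell (x , y)))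
       (≡.trans (≡.cong₂ (λ b θ → Ushape 1# b (cell (x , y)) (incr (cell (x , y)) (suc r)) θ (β (suc r)))
                         (addable-i+1 x y reach) (≡.cong (-_ ∘ α) (part-i+1 x y reach)))
                (Ushape-map cell 1# _ _ _ _ _ _ (incr-i+1 x y reach)))

    origin-reachable : All Reachableᶜ origin
    origin-reachable = (BelowGap-zero g₁ , z≤n) ∷ []

    basis-embed : basis λ′ ≡ embed cell origin
    basis-embed = ≡.cong (λ μ → [ (1# , μ) ]) (≡.sym cell-origin)

    lhs-embed : (U (suc r) ⊕ U (suc (suc r))) (U (suc (suc r)) (U (suc r) (basis λ′))) ≡ embed cell lhs
    lhs-embed = begin
      (U (suc r) ⊕ U (suc (suc r))) (U (suc (suc r)) (U (suc r) (basis λ′)))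
        ≡⟨ ≡.cong (λ w → (U (suc r) ⊕ U (suc (suc r))) (U (suc (suc r)) (U (suc r) w))) basis-embed ⟩
      (U (suc r) ⊕ U (suc (suc r))) (U (suc (suc r)) (U (suc r) (embed cell origin)))
        ≡⟨ ≡.cong (λ w → (U (suc r) ⊕ U (suc (suc r))) (U (suc (suc r)) w)) (Uᵢ-embed origin origin-reachable) ⟩
      (U (suc r) ⊕ U (suc (suc r))) (U (suc (suc r)) (embed cell w₁))
        ≡⟨ ≡.cong (U (suc r) ⊕ U (suc (suc r))) (Uᵢ₊₁-embed w₁ w₁-reachable) ⟩
      U (suc r) (embed cell w₂) ++ U (suc (suc r)) (embed cell w₂)
        ≡⟨ ≡.cong₂ _++_ (Uᵢ-embed w₂ w₂-reachable) (Uᵢ₊₁-embed w₂ w₂-reachable) ⟩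
      embed cell (Uᵢᶜ w₂) ++ embed cell (Uᵢ₊₁ᶜ w₂)
        ≡⟨ LP.map-++ _ (Uᵢᶜ w₂) (Uᵢ₊₁ᶜ w₂) ⟨
      embed cell lhs ∎
      where
      open ≡.≡-Reasoning
      w₁ = Uᵢᶜ origin
      w₁-reachable = Uᵢᶜ-reachable origin origin-reachable
      w₂ = Uᵢ₊₁ᶜ w₁
      w₂-reachable = Uᵢ₊₁ᶜ-reachable w₁ w₁-reachable

    rhs-embed : U (suc (suc r)) (U (suc r) ((U (suc r) ⊕ U (suc (suc r))) (basis λ′))) ≡ embed cell rhs
    rhs-embed = begin
      U (suc (suc r)) (U (suc r) ((U (suc r) ⊕ U (suc (suc r))) (basis λ′)))
        ≡⟨ ≡.cong (λ w → U (suc (suc r)) (U (suc r) ((U (suc r) ⊕ U (suc (suc r))) w))) basis-embed ⟩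
      U (suc (suc r)) (U (suc r) (U (suc r) (embed cell origin) ++ U (suc (suc r)) (embed cell origin)))
        ≡⟨ ≡.cong (λ w → U (suc (suc r)) (U (suc r) w))
                  (≡.trans (≡.cong₂ _++_ (Uᵢ-embed origin origin-reachable) (Uᵢ₊₁-embed origin origin-reachable))
                           (≡.sym (LP.map-++ _ (Uᵢᶜ origin) (Uᵢ₊₁ᶜ origin)))) ⟩
      U (suc (suc r)) (U (suc r) (embed cell w₁))
        ≡⟨ ≡.cong (U (suc (suc r))) (Uᵢ-embed w₁ w₁-reachable) ⟩
      U (suc (suc r)) (embed cell (Uᵢᶜ w₁))
        ≡⟨ Uᵢ₊₁-embed (Uᵢᶜ w₁) (Uᵢᶜ-reachable w₁ w₁-reachable) ⟩
      embed cell rhs ∎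
      where
      open ≡.≡-Reasoning
      w₁ = Uᵢᶜ origin ++ Uᵢ₊₁ᶜ origin
      w₁-reachable = AllP.++⁺ (Uᵢᶜ-reachable origin origin-reachable) (Uᵢ₊₁ᶜ-reachable origin origin-reachable)

  -- Θ-coefficients are only taken at x, y ≤ 1. For g₂ = 0 those of the two rows
  -- coincide (λ_i + x = λ_{i+1} + x), and the identity below depends on it.
  θᵢ₊₁ˢ : ℕ → Polynomial 14
  θᵢ₊₁ˢ zero    = var (# 2)
  θᵢ₊₁ˢ (suc _) = var (# 3)

  θᵢˢ : ℕ → ℕ → Polynomial 14
  θᵢˢ zero    x       = θᵢ₊₁ˢ x
  θᵢˢ (suc _) zero    = var (# 4)
  θᵢˢ (suc _) (suc _) = var (# 5)

  module SymbolicModel (g₁ : Maybe ℕ) (g₂ : ℕ) =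
    LocalModel (con 1) _:*_ (θᵢˢ g₂) θᵢ₊₁ˢ (var (# 0)) (var (# 1)) g₁ g₂

  cellAtom : Cell → Fin 14
  cellAtom (0 , 0) = # 6
  cellAtom (1 , 0) = # 7
  cellAtom (0 , 1) = # 8
  cellAtom (2 , 0) = # 9
  cellAtom (1 , 1) = # 10
  cellAtom (0 , 2) = # 11
  cellAtom (2 , 1) = # 12
  cellAtom (1 , 2) = # 13
  cellAtom _       = # 6

  pairingˢ : List (Polynomial 14 × Cell) → Polynomial 14
  pairingˢ []            = con 0
  pairingˢ ((k , p) ∷ w) = k :* var (cellAtom p) :+ pairingˢ w

  atoms : ℕ → ℕ → ℕ → (Cell → List ℕ) → List ℕ → V.Vec Carrier 14
  atoms r g₂ c cell μ =
    β r V.∷ β (suc r) V.∷ θᵢ₊₁ c 0 V.∷ θᵢ₊₁ c 1 V.∷ θᵢ g₂ c 0 V.∷ θᵢ g₂ c 1 V.∷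
    δ (cell (0 , 0)) μ V.∷ δ (cell (1 , 0)) μ V.∷ δ (cell (0 , 1)) μ V.∷ δ (cell (2 , 0)) μ V.∷
    δ (cell (1 , 1)) μ V.∷ δ (cell (0 , 2)) μ V.∷ δ (cell (2 , 1)) μ V.∷ δ (cell (1 , 2)) μ V.∷ V.[]

  lhsˢ rhsˢ : Maybe ℕ → ℕ → Polynomial 14
  lhsˢ g₁ g₂ = pairingˢ (SymbolicModel.lhs g₁ g₂)
  rhsˢ g₁ g₂ = pairingˢ (SymbolicModel.rhs g₁ g₂)

  -- The words of length three only reach cells with x, y ≤ 2, so g₁ and g₂ matter
  -- only up to 2; in each case the ring solver compares the symbolic expansions.
  local-identity : ∀ r g₁ g₂ c cell μ → pairing (λ λ′ → δ λ′ μ) (embed cell (Model.lhs r g₁ g₂ c))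
                                        ≈ pairing (λ λ′ → δ λ′ μ) (embed cell (Model.rhs r g₁ g₂ c))
  local-identity r g₁@nothing               g₂@0             c cell μ = prove (atoms r g₂ c cell μ) (lhsˢ g₁ g₂) (rhsˢ g₁ g₂) refl
  local-identity r g₁@nothing               g₂@1             c cell μ = prove (atoms r g₂ c cell μ) (lhsˢ g₁ g₂) (rhsˢ g₁ g₂) refl
  local-identity r g₁@nothing               g₂@(suc (suc _)) c cell μ = prove (atoms r g₂ c cell μ) (lhsˢ g₁ g₂) (rhsˢ g₁ g₂) refl
  local-identity r g₁@(just 0)              g₂@0             c cell μ = prove (atoms r g₂ c cell μ) (lhsˢ g₁ g₂) (rhsˢ g₁ g₂) refl
  local-identity r g₁@(just 0)              g₂@1             c cell μ = prove (atoms r g₂ c cell μ) (lhsˢ g₁ g₂) (rhsˢ g₁ g₂) refl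
  local-identity r g₁@(just 0)              g₂@(suc (suc _)) c cell μ = prove (atoms r g₂ c cell μ) (lhsˢ g₁ g₂) (rhsˢ g₁ g₂) refl
  local-identity r g₁@(just 1)              g₂@0             c cell μ = prove (atoms r g₂ c cell μ) (lhsˢ g₁ g₂) (rhsˢ g₁ g₂) refl
  local-identity r g₁@(just 1)              g₂@1             c cell μ = prove (atoms r g₂ c cell μ) (lhsˢ g₁ g₂) (rhsˢ g₁ g₂) refl
  local-identity r g₁@(just 1)              g₂@(suc (suc _)) c cell μ = prove (atoms r g₂ c cell μ) (lhsˢ g₁ g₂) (rhsˢ g₁ g₂) refl
  local-identity r g₁@(just (suc (suc _))) g₂@0             c cell μ = prove (atoms r g₂ c cell μ) (lhsˢ g₁ g₂) (rhsˢ g₁ g₂) refl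
  local-identity r g₁@(just (suc (suc _))) g₂@1             c cell μ = prove (atoms r g₂ c cell μ) (lhsˢ g₁ g₂) (rhsˢ g₁ g₂) refl
  local-identity r g₁@(just (suc (suc _))) g₂@(suc (suc _)) c cell μ = prove (atoms r g₂ c cell μ) (lhsˢ g₁ g₂) (rhsˢ g₁ g₂) refl

  U-adjacent-basis : ∀ r λ′ → Chart r λ′ →
    (U (suc r) ⊕ U (suc (suc r))) (U (suc (suc r)) (U (suc r) (basis λ′)))
    ≋ U (suc (suc r)) (U (suc r) ((U (suc r) ⊕ U (suc (suc r))) (basis λ′)))
  U-adjacent-basis r λ′ χ =
    ≡⇒≋ lhs-embed
    ⟫ ≋-by-δ _ _ (local-identity r g₁ g₂ λᵢ₊₁ cell)
    ⟫ ≋-sym (≡⇒≋ rhs-embed)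
    where
    open Chart χ
    open ChartEmbedding χ

  U-adjacent : ∀ r v → InKP v →
    (U (suc r) ⊕ U (suc (suc r))) (U (suc (suc r)) (U (suc r) v))
    ≋ U (suc (suc r)) (U (suc r) ((U (suc r) ⊕ U (suc (suc r))) v))
  U-adjacent r =
    linear-ext IsPartition (∘-isLinear (⊕-isLinear Uᵢ Uᵢ₊₁) (∘-isLinear Uᵢ₊₁ Uᵢ))
                           (∘-isLinear Uᵢ₊₁ (∘-isLinear Uᵢ (⊕-isLinear Uᵢ Uᵢ₊₁)))
               (λ λ′ λ′-partition → U-adjacent-basis r λ′ (chart r λ′ λ′-partition))
    where
    Uᵢ   = U-isLinear (suc r)
    Uᵢ₊₁ = U-isLinear (suc (suc r))

open import Data.Nat using (_≤_; _<_; _+_)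

lemma3p2 : {c ℓ : Level} (R : CommutativeRing c ℓ) → IsFieldChar0 R →
    (α β : ℕ → CommutativeRing.Carrier R) →
    CommutativeRing._≈_ R (α 0) (CommutativeRing.0# R) →
    let open KP R α β in
      (∀ i j k → 1 ≤ k → k < j → j ≤ i → 2 + k ≤ i →
        ∀ v → InKP v → (U j ∘ U i ∘ U k) v ≈V (U j ∘ U k ∘ U i) v)
    × (∀ i j k → 1 ≤ k → k ≤ j → j < i → 2 + k ≤ i →
        ∀ v → InKP v → (U i ∘ U k ∘ U j) v ≈V (U k ∘ U i ∘ U j) v)
    × (∀ i → 1 ≤ i →
        ∀ v → InKP v → ((U i ⊕ U (suc i)) ∘ U (suc i) ∘ U i) v
                        ≈V (U (suc i) ∘ U i ∘ (U i ⊕ U (suc i))) v)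
lemma3p2 R _ α β _ =
    (λ i j k 1≤k _ _ 2+k≤i v _ → unbox (linExt-cong (Uᵇ j) (U-comm i k 1≤k 2+k≤i v)))
  , (λ i j k 1≤k _ _ 2+k≤i v _ → unbox (U-comm i k 1≤k 2+k≤i (U j v)))
  , λ { zero () ; (suc r) _ v v∈KP → unbox (U-adjacent r v v∈KP) }
  where
  open KP R α β
  open FormalSums R α β
  open KnuthRelations R α β
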